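{- Let $p\ge3$ be prime, $b_1,b_2\in\mathbb{Z}_p^\times$, $b_3\in\mathbb{Z}_p$, $c_1,c_2,c_3\in\mathbb{Z}_p$, and $\alpha\in p\mathbb{Z}_p$, and assume that $\alpha\in p^2\mathbb{Z}_p$ or $b_3\in\mathbb{Z}_p^\times$. If the polynomial $f(x_1,x_2,x_3)=b_1x_1^2+c_1x_1+b_2x_2^2+c_2x_2+\alpha(b_3x_3^2+c_3x_3)$ represents every class of $\mathbb{Z}/p^2\mathbb{Z}$ (i.e. for every $k\in\mathbb{Z}$ there are $x_1,x_2,x_3\in\mathbb{Z}_p$ with $f(x_1,x_2,x_3)\equiv k\pmod{p^2}$), then $\left(\frac{ -b_1b_2}{p}\right)=1$.
   Context: $\left(\frac{u}{p}\right)$ for $u\in\mathbb{Z}_p^\times$ denotes the Legendre symbol of the reduction of $u$ modulo $p$. -}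

module Defs where

open import Data.Nat using (ℕ; suc; _^_)
open import Data.Integer using (ℤ; +_; _+_; _*_; -_; _-_)
open import Data.Integer.Divisibility.Signed using (_∣_; ∣m∣n⇒∣m+n; ∣m⇒∣-m; ∣n⇒∣m*n; ∣m⇒∣m*n; ∣-refl)
open import Data.Integer.Tactic.RingSolver using (solve-∀)
open import Data.Product using (Σ; _×_)
open import Relation.Binary.PropositionalEquality using (_≡_; subst; sym)
open import Relation.Nullary using (¬_)

-- The p-adic integers ℤ_p, as coherent sequences of integer representatives:
-- seq n is a representative of the reduction of the element modulo p^n,
-- and seq (n+1) ≡ seq n (mod p^n).
record ℤ[_] (p : ℕ) : Set where
  constructor mkℤp
  field
    seq : ℕ → ℤ
    coh : ∀ n → (+ (p ^ n)) ∣ (seq (suc n) - seq n)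
open ℤ[_] public

private
  addLemma : ∀ a b c d → (a + b) - (c + d) ≡ (a - c) + (b - d)
  addLemma = solve-∀
  negLemma : ∀ a c → (- a) - (- c) ≡ - (a - c)
  negLemma = solve-∀
  mulLemma : ∀ a b c d → (a * b) - (c * d) ≡ a * (b - d) + (a - c) * d
  mulLemma = solve-∀

module _ {p : ℕ} where
  ι : ℤ → ℤ[ p ]
  ι k = mkℤp (λ _ → k) (λ n → subst (λ z → (+ (p ^ n)) ∣ z) (sym (zeroLemma k (+ (p ^ n))))
                              (∣n⇒∣m*n (+ 0) {+ (p ^ n)} ∣-refl))
    where
    zeroLemma : ∀ a q → a - a ≡ + 0 * q
    zeroLemma = solve-∀

  infixl 6 _+ₚ_ _-ₚ_
  infixl 7 _*ₚ_

  _+ₚ_ : ℤ[ p ] → ℤ[ p ] → ℤ[ p ]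
  x +ₚ y = mkℤp (λ n → seq x n + seq y n)
    (λ n → subst (λ z → (+ (p ^ n)) ∣ z)
      (sym (addLemma (seq x (suc n)) (seq y (suc n)) (seq x n) (seq y n)))
      (∣m∣n⇒∣m+n (coh x n) (coh y n)))

  -ₚ_ : ℤ[ p ] → ℤ[ p ]
  -ₚ x = mkℤp (λ n → - seq x n)
    (λ n → subst (λ z → (+ (p ^ n)) ∣ z)
      (sym (negLemma (seq x (suc n)) (seq x n)))
      (∣m⇒∣-m (coh x n)))

  _-ₚ_ : ℤ[ p ] → ℤ[ p ] → ℤ[ p ]
  x -ₚ y = x +ₚ (-ₚ y)

  _*ₚ_ : ℤ[ p ] → ℤ[ p ] → ℤ[ p ]
  x *ₚ y = mkℤp (λ n → seq x n * seq y n)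
    (λ n → subst (λ z → (+ (p ^ n)) ∣ z)
      (sym (mulLemma (seq x (suc n)) (seq y (suc n)) (seq x n) (seq y n)))
      (∣m∣n⇒∣m+n (∣n⇒∣m*n (seq x (suc n)) (coh y n)) (∣m⇒∣m*n (seq y n) (coh x n))))

  _∈pow_ : ℤ[ p ] → ℕ → Set
  x ∈pow m = (+ (p ^ m)) ∣ seq x m

  Unit : ℤ[ p ] → Set
  Unit x = ¬ (x ∈pow 1)

  _≡[mod-pow_]_ : ℤ[ p ] → ℕ → ℤ → Set
  x ≡[mod-pow m ] k = (x -ₚ ι k) ∈pow m

  red : ℤ[ p ] → ℤ
  red x = seq x 1

LegendreIsOne : ℤ → ℕ → Set
LegendreIsOne a p = ¬ ((+ p) ∣ a) × Σ ℤ (λ y → (+ p) ∣ (y * y - a))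

-- Suppose −b₁b₂ is not a square mod p, so that the binary form b₁d₁² + b₂d₂² is anisotropic
-- mod p, and pick xᵢ with 2bᵢxᵢ + cᵢ ≡ 0 mod p (completing the square; qᵢ(x) = bᵢx² + cᵢx).
-- For every t, surjectivity gives X with f(X) ≡ q₁(x₁) + q₂(x₂) + p t mod p². Modulo p the
-- binary form then vanishes at X − x, so X ≡ x mod p, hence qᵢ(Xᵢ) ≡ qᵢ(xᵢ) mod p² and
-- α(b₃X₃² + c₃X₃) ≡ p t mod p².
-- If p² ∣ α this fails for t = 1.  Otherwise α = a p with a, b₃ units, and a(b₃X² + c₃X)
-- takes every value mod p; but 4ab₃·a(b₃X² + c₃X) + (ac₃)² = (2ab₃X + ac₃)², so hitting
-- (−b₁b₂ − (ac₃)²)/(4ab₃) would make −b₁b₂ a square.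

module Submission where

open import Defs
open import Data.Nat as ℕ using (ℕ; _≤_; _^_)
import Data.Nat.Properties as ℕ
import Data.Nat.Divisibility as ℕ
open import Data.Nat.Primality using (Prime; euclidsLemma; prime⇒nonZero; prime⇒irreducible)
open import Data.Nat.Coprimality using (Coprime; coprime-Bézout)
open import Data.Nat.GCD using (module Bézout)
open import Data.Integer using (ℤ; +_; _+_; _*_; -_; _-_; 0ℤ; 1ℤ; NonZero) renaming (∣_∣ to abs)
open import Data.Integer.Properties using (abs-*; pos-*; neg-distribˡ-*; +-identityʳ; +-assoc; neg-involutive)
open import Data.Integer.Divisibility.Signed
open import Data.Integer.DivMod using (_%ℕ_; _/ℕ_; a≡a%ℕn+[a/ℕn]*n; n%ℕd<d)
open import Data.Integer.Tactic.RingSolver using (solve-∀)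
open import Data.Fin using (Fin; toℕ; fromℕ<)
open import Data.Fin.Properties using (any?; toℕ-fromℕ<)
open import Data.Product using (Σ; _×_; _,_; proj₁; proj₂; map₂)
open import Data.Sum using (_⊎_; inj₁; inj₂; [_,_]′; reduce)
import Data.Sum as Sum
open import Data.Empty using (⊥-elim)
open import Function using (_∘_; id)
open import Relation.Binary.Bundles using (Setoid)
import Relation.Binary.Reasoning.Setoid as SetoidReasoning
open import Relation.Nullary using (¬_; yes; no; Dec)
open import Relation.Nullary.Decidable using (decidable-stable; map′)
open import Relation.Binary.PropositionalEquality using (_≡_; refl; subst; sym; trans; cong; module ≡-Reasoning)

variable
  a b c d m n n′ r s u w : ℤ

infix 4 _≡_[mod_]
-- A record rather than a function, so that a, b and m can be inferred from a proof.
record _≡_[mod_] (a b m : ℤ) : Set where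
  constructor ≡-mod
  field
    ∣-difference : m ∣ a - b
open _≡_[mod_]

≡-mod-reflexive : a ≡ b → a ≡ b [mod m ]
≡-mod-reflexive {a = a} {m = m} refl = ≡-mod (divides 0ℤ (a-a≡0*m a m))
  where
  a-a≡0*m : ∀ a m → a - a ≡ 0ℤ * m
  a-a≡0*m = solve-∀

≡-mod-refl : a ≡ a [mod m ]
≡-mod-refl = ≡-mod-reflexive refl

≡-mod-sym : a ≡ b [mod m ] → b ≡ a [mod m ]
≡-mod-sym {a = a} {b = b} (≡-mod h) = ≡-mod (subst (_ ∣_) (flip a b) (∣m⇒∣-m h))
  where
  flip : ∀ a b → - (a - b) ≡ b - a
  flip = solve-∀

≡-mod-trans : a ≡ b [mod m ] → b ≡ c [mod m ] → a ≡ c [mod m ]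
≡-mod-trans {a = a} {b = b} {c = c} (≡-mod h) (≡-mod h′) =
  ≡-mod (subst (_ ∣_) (telescope a b c) (∣m∣n⇒∣m+n h h′))
  where
  telescope : ∀ a b c → (a - b) + (b - c) ≡ a - c
  telescope = solve-∀

≡-mod-+-cong : a ≡ b [mod m ] → c ≡ d [mod m ] → a + c ≡ b + d [mod m ]
≡-mod-+-cong {a = a} {b = b} {c = c} {d = d} (≡-mod h) (≡-mod h′) =
  ≡-mod (subst (_ ∣_) (regroup a b c d) (∣m∣n⇒∣m+n h h′))
  where
  regroup : ∀ a b c d → (a - b) + (c - d) ≡ (a + c) - (b + d)
  regroup = solve-∀

≡-mod-neg-cong : a ≡ b [mod m ] → - a ≡ - b [mod m ]
≡-mod-neg-cong {a = a} {b = b} (≡-mod h) = ≡-mod (subst (_ ∣_) (negate a b) (∣m⇒∣-m h))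
  where
  negate : ∀ a b → - (a - b) ≡ - a - - b
  negate = solve-∀

≡-mod-*-cong : a ≡ b [mod m ] → c ≡ d [mod m ] → a * c ≡ b * d [mod m ]
≡-mod-*-cong {a = a} {b = b} {c = c} {d = d} (≡-mod h) (≡-mod h′) =
  ≡-mod (subst (_ ∣_) (regroup a b c d) (∣m∣n⇒∣m+n (∣n⇒∣m*n a h′) (∣m⇒∣m*n d h)))
  where
  regroup : ∀ a b c d → a * (c - d) + (a - b) * d ≡ a * c - b * d
  regroup = solve-∀

≡-mod-+-congˡ : ∀ a → b ≡ c [mod m ] → a + b ≡ a + c [mod m ]
≡-mod-+-congˡ a = ≡-mod-+-cong (≡-mod-refl {a = a})

≡-mod-+-congʳ : ∀ c → a ≡ b [mod m ] → a + c ≡ b + c [mod m ]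
≡-mod-+-congʳ c h = ≡-mod-+-cong h (≡-mod-refl {a = c})

≡-mod-*-congˡ : ∀ a → b ≡ c [mod m ] → a * b ≡ a * c [mod m ]
≡-mod-*-congˡ a = ≡-mod-*-cong (≡-mod-refl {a = a})

≡-mod-*-congʳ : ∀ c → a ≡ b [mod m ] → a * c ≡ b * c [mod m ]
≡-mod-*-congʳ c h = ≡-mod-*-cong h (≡-mod-refl {a = c})

≡-mod-setoid : ℤ → Setoid _ _
≡-mod-setoid m = record
  { Carrier       = ℤ
  ; _≈_           = λ a b → a ≡ b [mod m ]
  ; isEquivalence = record { refl = ≡-mod-refl ; sym = ≡-mod-sym ; trans = ≡-mod-trans }
  }

module ≡-mod-Reasoning (m : ℤ) = SetoidReasoning (≡-mod-setoid m)

∣⇒≡-mod-0 : m ∣ a → a ≡ 0ℤ [mod m ]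
∣⇒≡-mod-0 {a = a} = ≡-mod ∘ subst (_ ∣_) (sym (+-identityʳ a))

≡-mod-0⇒∣ : a ≡ 0ℤ [mod m ] → m ∣ a
≡-mod-0⇒∣ {a = a} (≡-mod h) = subst (_ ∣_) (+-identityʳ a) h

∣-respʳ-≡-mod : a ≡ b [mod m ] → m ∣ a → m ∣ b
∣-respʳ-≡-mod {a = a} {b = b} (≡-mod h) m∣a = subst (_ ∣_) (cancel a b) (∣m∣n⇒∣m-n m∣a h)
  where
  cancel : ∀ a b → a - (a - b) ≡ b
  cancel = solve-∀

≡-mod-weaken : ∀ k → a ≡ b [mod m * k ] → a ≡ b [mod m ]
≡-mod-weaken k (≡-mod h) = ≡-mod (∣-trans (∣m⇒∣m*n k ∣-refl) h)

+-cancelˡ-≡-mod : ∀ c → c + a ≡ c + b [mod m ] → a ≡ b [mod m ]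
+-cancelˡ-≡-mod {a = a} {b = b} c (≡-mod h) = ≡-mod (subst (_ ∣_) (cancel c a b) h)
  where
  cancel : ∀ c a b → (c + a) - (c + b) ≡ a - b
  cancel = solve-∀

*-cancelˡ-≡-mod : ∀ k .{{_ : NonZero k}} → k * a ≡ k * b [mod k * m ] → a ≡ b [mod m ]
*-cancelˡ-≡-mod {a = a} {b = b} k (≡-mod h) = ≡-mod (*-cancelˡ-∣ k (subst (_ ∣_) (factor k a b) h))
  where
  factor : ∀ k a b → k * a - k * b ≡ k * (a - b)
  factor = solve-∀

SquareMod : ℤ → ℤ → Set
SquareMod m n = Σ ℤ λ y → y * y ≡ n [mod m ]

SquareMod-resp : n ≡ n′ [mod m ] → SquareMod m n → SquareMod m n′
SquareMod-resp n≡n′ (y , y²≡n) = y , ≡-mod-trans y²≡n n≡n′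

quadratic : ℤ → ℤ → ℤ → ℤ
quadratic b c x = b * x * x + c * x

*-pres-∣ : m ∣ a → n ∣ b → m * n ∣ a * b
*-pres-∣ {m = m} {n = n} (divides q refl) (divides q′ refl) =
  divides (q * q′) (interchange q m q′ n)
  where
  interchange : ∀ q m q′ n → q * m * (q′ * n) ≡ q * q′ * (m * n)
  interchange = solve-∀

quadratic-at-critical-point : ∀ b c x X → m ∣ + 2 * b * x + c →
  quadratic b c X ≡ quadratic b c x + b * ((X - x) * (X - x)) [mod m ]
quadratic-at-critical-point b c x X m∣q′x =
  ≡-mod (subst (_ ∣_) (sym (taylor b c x X)) (∣m⇒∣m*n (X - x) m∣q′x))
  where
  taylor : ∀ b c x X →
    b * X * X + c * X - (b * x * x + c * x + b * ((X - x) * (X - x)))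
      ≡ (+ 2 * b * x + c) * (X - x)
  taylor = solve-∀

quadratic-flat-at-critical-point : ∀ b c x X → m ∣ + 2 * b * x + c → m ∣ X - x →
  quadratic b c X ≡ quadratic b c x [mod m * m ]
quadratic-flat-at-critical-point b c x X m∣q′x m∣X-x =
  ≡-mod (subst (_ ∣_) (sym (taylor b c x X))
    (∣m∣n⇒∣m+n (*-pres-∣ m∣q′x m∣X-x) (∣n⇒∣m*n b (*-pres-∣ m∣X-x m∣X-x))))
  where
  taylor : ∀ b c x X →
    b * X * X + c * X - (b * x * x + c * x)
      ≡ (+ 2 * b * x + c) * (X - x) + b * ((X - x) * (X - x))
  taylor = solve-∀

isotropic⇒square : ∀ b₁ b₂ d₁ d₂ → b₁ * (d₁ * d₁) + b₂ * (d₂ * d₂) ≡ 0ℤ [mod m ] →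
  d₁ * w ≡ 1ℤ [mod m ] → SquareMod m (- (b₁ * b₂))
isotropic⇒square {m = m} {w = w} b₁ b₂ d₁ d₂ form≡0 d₁w≡1 =
  b₂ * d₂ * w , (begin
    b₂ * d₂ * w * (b₂ * d₂ * w)
      ≡⟨ expand b₁ b₂ d₁ d₂ w ⟩
    b₂ * w * w * (b₁ * (d₁ * d₁) + b₂ * (d₂ * d₂)) - b₁ * b₂ * (d₁ * w * (d₁ * w))
      ≈⟨ ≡-mod-+-cong (≡-mod-*-congˡ (b₂ * w * w) form≡0)
                      (≡-mod-neg-cong (≡-mod-*-congˡ (b₁ * b₂) (≡-mod-*-cong d₁w≡1 d₁w≡1))) ⟩
    b₂ * w * w * 0ℤ - b₁ * b₂ * (1ℤ * 1ℤ)
      ≡⟨ collapse b₁ b₂ w ⟩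
    - (b₁ * b₂) ∎)
  where
  open ≡-mod-Reasoning m
  expand : ∀ b₁ b₂ d₁ d₂ w → b₂ * d₂ * w * (b₂ * d₂ * w)
    ≡ b₂ * w * w * (b₁ * (d₁ * d₁) + b₂ * (d₂ * d₂)) - b₁ * b₂ * (d₁ * w * (d₁ * w))
  expand = solve-∀
  collapse : ∀ b₁ b₂ w → b₂ * w * w * 0ℤ - b₁ * b₂ * (1ℤ * 1ℤ) ≡ - (b₁ * b₂)
  collapse = solve-∀

quadratic-misses : ∀ a c → ¬ SquareMod m n → + 4 * a * w ≡ 1ℤ [mod m ] →
  ∀ X → ¬ quadratic a c X ≡ (n - c * c) * w [mod m ]
quadratic-misses {m = m} {n = n} {w = w} a c nonsquare 4aw≡1 X hit =
  nonsquare (+ 2 * a * X + c , (begin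
    (+ 2 * a * X + c) * (+ 2 * a * X + c) ≡⟨ complete-square a c X ⟩
    + 4 * a * quadratic a c X + c * c     ≈⟨ ≡-mod-+-congʳ (c * c) (≡-mod-*-congˡ (+ 4 * a) hit) ⟩
    + 4 * a * ((n - c * c) * w) + c * c   ≡⟨ regroup a c n w ⟩
    + 4 * a * w * (n - c * c) + c * c     ≈⟨ ≡-mod-+-congʳ (c * c) (≡-mod-*-congʳ (n - c * c) 4aw≡1) ⟩
    1ℤ * (n - c * c) + c * c              ≡⟨ cancel c n ⟩
    n                                     ∎))
  where
  open ≡-mod-Reasoning m
  complete-square : ∀ a c X →
    (+ 2 * a * X + c) * (+ 2 * a * X + c) ≡ + 4 * a * (a * X * X + c * X) + c * c
  complete-square = solve-∀
  regroup : ∀ a c n w → + 4 * a * ((n - c * c) * w) + c * c ≡ + 4 * a * w * (n - c * c) + c * c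
  regroup = solve-∀
  cancel : ∀ c n → 1ℤ * (n - c * c) + c * c ≡ n
  cancel = solve-∀

binary-form-vanishes : ∀ b₁ c₁ x₁ b₂ c₂ x₂ X₁ X₂ →
  m ∣ + 2 * b₁ * x₁ + c₁ → m ∣ + 2 * b₂ * x₂ + c₂ → m ∣ r → m ∣ s →
  quadratic b₁ c₁ X₁ + quadratic b₂ c₂ X₂ + r
    ≡ quadratic b₁ c₁ x₁ + quadratic b₂ c₂ x₂ + s [mod m ] →
  b₁ * ((X₁ - x₁) * (X₁ - x₁)) + b₂ * ((X₂ - x₂) * (X₂ - x₂)) ≡ 0ℤ [mod m ]
binary-form-vanishes {m = m} {r = r} {s = s} b₁ c₁ x₁ b₂ c₂ x₂ X₁ X₂
                     crit₁ crit₂ m∣r m∣s hit =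
  +-cancelˡ-≡-mod (q₁ x₁ + q₂ x₂) (begin
    q₁ x₁ + q₂ x₂ + (e₁ + e₂)   ≡⟨ regroup (q₁ x₁) (q₂ x₂) e₁ e₂ ⟩
    q₁ x₁ + e₁ + (q₂ x₂ + e₂) + 0ℤ
      ≈⟨ ≡-mod-+-cong (≡-mod-+-cong (quadratic-at-critical-point b₁ c₁ x₁ X₁ crit₁)
                                    (quadratic-at-critical-point b₂ c₂ x₂ X₂ crit₂))
                      (∣⇒≡-mod-0 m∣r) ⟨
    q₁ X₁ + q₂ X₂ + r           ≈⟨ hit ⟩
    q₁ x₁ + q₂ x₂ + s           ≈⟨ ≡-mod-+-congˡ (q₁ x₁ + q₂ x₂) (∣⇒≡-mod-0 m∣s) ⟩
    q₁ x₁ + q₂ x₂ + 0ℤ          ∎)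
  where
  open ≡-mod-Reasoning m
  q₁ q₂ : ℤ → ℤ
  q₁ = quadratic b₁ c₁
  q₂ = quadratic b₂ c₂
  e₁ e₂ : ℤ
  e₁ = b₁ * ((X₁ - x₁) * (X₁ - x₁))
  e₂ = b₂ * ((X₂ - x₂) * (X₂ - x₂))
  regroup : ∀ k₁ k₂ e₁ e₂ → k₁ + k₂ + (e₁ + e₂) ≡ k₁ + e₁ + (k₂ + e₂) + 0ℤ
  regroup = solve-∀

bézout⇒inverse : ∀ {r n} → Bézout.Identity 1 r n → Σ ℤ λ v → + r * v ≡ 1ℤ [mod + n ]
bézout⇒inverse {r} {n} (Bézout.+- x y eq) = + x , ≡-mod (divides (+ y) (begin
  + r * + x - 1ℤ          ≡⟨ cong (_- 1ℤ) (pos-* r x) ⟨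
  + (r ℕ.* x) - 1ℤ        ≡⟨ cong (λ z → + z - 1ℤ) (trans (ℕ.*-comm r x) (sym eq)) ⟩
  + (1 ℕ.+ y ℕ.* n) - 1ℤ  ≡⟨⟩
  + (y ℕ.* n)             ≡⟨ pos-* y n ⟩
  + y * + n               ∎))
  where open ≡-Reasoning
bézout⇒inverse {r} {n} (Bézout.-+ x y eq) = - + x , ≡-mod (divides (- + y) (begin
  + r * - + x - 1ℤ        ≡⟨ regroup (+ r) (+ x) ⟩
  - (1ℤ + + x * + r)      ≡⟨ cong (λ z → - (1ℤ + z)) (pos-* x r) ⟨
  - + (1 ℕ.+ x ℕ.* r)     ≡⟨ cong (λ z → - + z) eq ⟩
  - + (y ℕ.* n)           ≡⟨ cong -_ (pos-* y n) ⟩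
  - (+ y * + n)           ≡⟨ neg-distribˡ-* (+ y) (+ n) ⟩
  - + y * + n             ∎))
  where
  open ≡-Reasoning
  regroup : ∀ r x → r * - x - 1ℤ ≡ - (1ℤ + x * r)
  regroup = solve-∀

module _ {p : ℕ} .{{_ : ℕ.NonZero p}} where

  ≡-mod-%ℕ : ∀ a → a ≡ + (a %ℕ p) [mod + p ]
  ≡-mod-%ℕ a = ≡-mod (divides (a /ℕ p) (trans (cong (_- + (a %ℕ p)) (a≡a%ℕn+[a/ℕn]*n a p))
                                               (cancel (+ (a %ℕ p)) (a /ℕ p * + p))))
    where
    cancel : ∀ r s → r + s - r ≡ s
    cancel = solve-∀

  square-mod? : ∀ n → Dec (SquareMod (+ p) n)
  square-mod? n = map′ (λ (i , h) → + toℕ i , ≡-mod h) from-square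
                       (any? λ (i : Fin p) → + p ∣? + toℕ i * + toℕ i - n)
    where
    from-square : SquareMod (+ p) n → Σ (Fin p) λ i → + p ∣ + toℕ i * + toℕ i - n
    from-square (y , y²≡n) = i , ∣-difference (≡-mod-trans (≡-mod-*-cong i≡y i≡y) y²≡n)
      where
      i : Fin p
      i = fromℕ< (n%ℕd<d y p)
      i≡y : + toℕ i ≡ y [mod + p ]
      i≡y = subst (λ r → + r ≡ y [mod + p ]) (sym (toℕ-fromℕ< (n%ℕd<d y p)))
                  (≡-mod-sym (≡-mod-%ℕ y))

module _ {p : ℕ} (p-prime : Prime p) where

  private instance
    p≢0 : ℕ.NonZero p
    p≢0 = prime⇒nonZero p-prime

  prime-∣-* : + p ∣ a * b → + p ∣ a ⊎ + p ∣ b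
  prime-∣-* {a = a} {b = b} h =
    Sum.map ∣ᵤ⇒∣ ∣ᵤ⇒∣ (euclidsLemma (abs a) (abs b) p-prime (subst (p ℕ.∣_) (abs-* a b) (∣⇒∣ᵤ h)))

  prime-∤-* : ¬ + p ∣ a → ¬ + p ∣ b → ¬ + p ∣ a * b
  prime-∤-* p∤a p∤b = [ p∤a , p∤b ]′ ∘ prime-∣-*

  prime-∣-square : + p ∣ a * a → + p ∣ a
  prime-∣-square = reduce ∘ prime-∣-*

  mod-inverse : ¬ + p ∣ u → Σ ℤ λ v → u * v ≡ 1ℤ [mod + p ]
  mod-inverse {u = u} p∤u =
    let v , rv≡1 = bézout⇒inverse (coprime-Bézout r-coprime)
    in v , ≡-mod-trans (≡-mod-*-congʳ v (≡-mod-%ℕ u)) rv≡1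
    where
    r-coprime : Coprime (u %ℕ p) p
    r-coprime (d∣r , d∣p) with prime⇒irreducible p-prime d∣p
    ... | inj₁ d≡1 = d≡1
    ... | inj₂ refl = ⊥-elim (p∤u (∣-respʳ-≡-mod (≡-mod-sym (≡-mod-%ℕ u)) (∣ᵤ⇒∣ d∣r)))

  linear-root : ¬ + p ∣ u → ∀ c → Σ ℤ λ x → + p ∣ u * x + c
  linear-root {u = u} p∤u c =
    let v , uv≡1 = mod-inverse p∤u
    in - (c * v) , subst (_ ∣_) (root u c v) (∣n⇒∣m*n (- c) (∣-difference uv≡1))
    where
    root : ∀ u c v → - c * (u * v - 1ℤ) ≡ u * - (c * v) + c
    root = solve-∀

  anisotropic : ∀ b₁ b₂ d₁ d₂ → ¬ SquareMod (+ p) (- (b₁ * b₂)) → ¬ + p ∣ b₂ →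
    b₁ * (d₁ * d₁) + b₂ * (d₂ * d₂) ≡ 0ℤ [mod + p ] → + p ∣ d₁ × + p ∣ d₂
  anisotropic b₁ b₂ d₁ d₂ nonsquare p∤b₂ form≡0 with + p ∣? d₁
  ... | no p∤d₁ =
    ⊥-elim (nonsquare (isotropic⇒square b₁ b₂ d₁ d₂ form≡0 (proj₂ (mod-inverse p∤d₁))))
  ... | yes p∣d₁ =
    p∣d₁ , prime-∣-square ([ ⊥-elim ∘ p∤b₂ , id ]′ (prime-∣-* p∣b₂d₂²))
    where
    p∣b₂d₂² : + p ∣ b₂ * (d₂ * d₂)
    p∣b₂d₂² = ∣m+n∣m⇒∣n {m = b₁ * (d₁ * d₁)} (≡-mod-0⇒∣ form≡0) (∣n⇒∣m*n b₁ (∣m⇒∣m*n d₁ p∣d₁))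

  binary-part-cancels : ∀ b₁ c₁ x₁ b₂ c₂ x₂ X₁ X₂ →
    ¬ SquareMod (+ p) (- (b₁ * b₂)) → ¬ + p ∣ b₂ →
    + p ∣ + 2 * b₁ * x₁ + c₁ → + p ∣ + 2 * b₂ * x₂ + c₂ → + p ∣ r → + p ∣ s →
    quadratic b₁ c₁ X₁ + quadratic b₂ c₂ X₂ + r
      ≡ quadratic b₁ c₁ x₁ + quadratic b₂ c₂ x₂ + s [mod + p * + p ] →
    r ≡ s [mod + p * + p ]
  binary-part-cancels {r = r} {s = s} b₁ c₁ x₁ b₂ c₂ x₂ X₁ X₂
                      nonsquare p∤b₂ crit₁ crit₂ p∣r p∣s hit =
    +-cancelˡ-≡-mod (q₁ x₁ + q₂ x₂) (begin
      q₁ x₁ + q₂ x₂ + r  ≈⟨ ≡-mod-+-congʳ r (≡-mod-+-cong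
                               (quadratic-flat-at-critical-point b₁ c₁ x₁ X₁ crit₁ p∣d₁)
                               (quadratic-flat-at-critical-point b₂ c₂ x₂ X₂ crit₂ p∣d₂)) ⟨
      q₁ X₁ + q₂ X₂ + r  ≈⟨ hit ⟩
      q₁ x₁ + q₂ x₂ + s  ∎)
    where
    open ≡-mod-Reasoning (+ p * + p)
    q₁ q₂ : ℤ → ℤ
    q₁ = quadratic b₁ c₁
    q₂ = quadratic b₂ c₂
    p∣d₁×p∣d₂ : + p ∣ X₁ - x₁ × + p ∣ X₂ - x₂
    p∣d₁×p∣d₂ = anisotropic b₁ b₂ (X₁ - x₁) (X₂ - x₂) nonsquare p∤b₂
      (binary-form-vanishes b₁ c₁ x₁ b₂ c₂ x₂ X₁ X₂ crit₁ crit₂ p∣r p∣s (≡-mod-weaken (+ p) hit))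
    p∣d₁ : + p ∣ X₁ - x₁
    p∣d₁ = proj₁ p∣d₁×p∣d₂
    p∣d₂ : + p ∣ X₂ - x₂
    p∣d₂ = proj₂ p∣d₁×p∣d₂

module _ {p : ℕ} (p-prime : Prime p) (p≥3 : 3 ≤ p) where

  private instance
    p≢0 : ℕ.NonZero p
    p≢0 = prime⇒nonZero p-prime

  p∤1 : ¬ + p ∣ 1ℤ
  p∤1 = ℕ.>⇒∤ (ℕ.≤-trans (ℕ.n≤1+n 2) p≥3) ∘ ∣⇒∣ᵤ

  p∤2 : ¬ + p ∣ + 2
  p∤2 = ℕ.>⇒∤ p≥3 ∘ ∣⇒∣ᵤ

  p∤4 : ¬ + p ∣ + 4
  p∤4 = prime-∤-* p-prime p∤2 p∤2

  critical-point : ¬ + p ∣ b → ∀ c → Σ ℤ λ x → + p ∣ + 2 * b * x + c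
  critical-point p∤b = linear-root p-prime (prime-∤-* p-prime p∤2 p∤b)

  p²-multiple-misses : ∀ a b c → + p * + p ∣ a →
    ∀ X → ¬ a * quadratic b c X ≡ + p * 1ℤ [mod + p * + p ]
  p²-multiple-misses a b c p²∣a X hit =
    p∤1 (*-cancelˡ-∣ (+ p) (∣-respʳ-≡-mod hit (∣m⇒∣m*n (quadratic b c X) p²∣a)))

  scaled-quadratic-misses : ∀ a b c → ¬ SquareMod (+ p) n → + p ∣ a → + p * + p ∣ a ⊎ ¬ + p ∣ b →
    Σ ℤ λ t → ∀ X → ¬ a * quadratic b c X ≡ + p * t [mod + p * + p ]
  scaled-quadratic-misses a b c _ _ (inj₁ p²∣a) = 1ℤ , p²-multiple-misses a b c p²∣a
  scaled-quadratic-misses {n = n} .(a′ * + p) b c nonsquare (divides a′ refl) (inj₂ p∤b)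
    with + p ∣? a′
  ... | yes p∣a′ = 1ℤ , p²-multiple-misses (a′ * + p) b c (*-monoˡ-∣ (+ p) p∣a′)
  ... | no p∤a′ =
    let w , 4a′bw≡1 = mod-inverse p-prime (prime-∤-* p-prime p∤4 (prime-∤-* p-prime p∤a′ p∤b))
    in (n - a′ * c * (a′ * c)) * w ,
       λ X hit → quadratic-misses (a′ * b) (a′ * c) nonsquare 4a′bw≡1 X
                   (*-cancelˡ-≡-mod (+ p)
                     (≡-mod-trans (≡-mod-reflexive (rescale a′ b c X (+ p))) hit))
    where
    rescale : ∀ a′ b c X p → p * (a′ * b * X * X + a′ * c * X) ≡ a′ * p * (b * X * X + c * X)
    rescale = solve-∀

  represents-mod-p²⇒square : ∀ b₁ c₁ b₂ c₂ a b₃ c₃ →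
    ¬ + p ∣ b₁ → ¬ + p ∣ b₂ → + p ∣ a → + p * + p ∣ a ⊎ ¬ + p ∣ b₃ →
    (∀ k → Σ ℤ λ X₁ → Σ ℤ λ X₂ → Σ ℤ λ X₃ →
       quadratic b₁ c₁ X₁ + quadratic b₂ c₂ X₂ + a * quadratic b₃ c₃ X₃ ≡ k [mod + p * + p ]) →
    ¬ ¬ SquareMod (+ p) (- (b₁ * b₂))
  represents-mod-p²⇒square b₁ c₁ b₂ c₂ a b₃ c₃ p∤b₁ p∤b₂ p∣a p²∣a⊎p∤b₃ onto nonsquare =
    let x₁ , crit₁ = critical-point p∤b₁ c₁
        x₂ , crit₂ = critical-point p∤b₂ c₂
        t , misses = scaled-quadratic-misses a b₃ c₃ nonsquare p∣a p²∣a⊎p∤b₃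
        X₁ , X₂ , X₃ , hit = onto (quadratic b₁ c₁ x₁ + quadratic b₂ c₂ x₂ + + p * t)
    in misses X₃ (binary-part-cancels p-prime b₁ c₁ x₁ b₂ c₂ x₂ X₁ X₂ nonsquare p∤b₂ crit₁ crit₂
                    (∣m⇒∣m*n (quadratic b₃ c₃ X₃) p∣a) (∣m⇒∣m*n t ∣-refl) hit)

module _ {p : ℕ} where

  p^1∣⇒p∣ : + (p ^ 1) ∣ a → + p ∣ a
  p^1∣⇒p∣ {a = a} = subst (λ q → + q ∣ a) (ℕ.*-identityʳ p)

  p∣⇒p^1∣ : + p ∣ a → + (p ^ 1) ∣ a
  p∣⇒p^1∣ {a = a} = subst (λ q → + q ∣ a) (sym (ℕ.*-identityʳ p))

  p^2∣⇒p*p∣ : + (p ^ 2) ∣ a → + p * + p ∣ a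
  p^2∣⇒p*p∣ {a = a} =
    subst (_∣ a) (trans (cong (λ q → + (p ℕ.* q)) (ℕ.*-identityʳ p)) (pos-* p p))

  ∈pow2⇒p*p∣seq₂ : (x : ℤ[ p ]) → x ∈pow 2 → + p * + p ∣ seq x 2
  ∈pow2⇒p*p∣seq₂ x = p^2∣⇒p*p∣

  seq₂≡seq₁ : (x : ℤ[ p ]) → seq x 2 ≡ seq x 1 [mod + p ]
  seq₂≡seq₁ x = ≡-mod (p^1∣⇒p∣ (coh x 1))

  unit⇒p∤seq₂ : (x : ℤ[ p ]) → Unit x → ¬ + p ∣ seq x 2
  unit⇒p∤seq₂ x x-unit = x-unit ∘ p∣⇒p^1∣ ∘ ∣-respʳ-≡-mod (seq₂≡seq₁ x)

  ∈pow1⇒p∣seq₂ : (x : ℤ[ p ]) → x ∈pow 1 → + p ∣ seq x 2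
  ∈pow1⇒p∣seq₂ x = ∣-respʳ-≡-mod (≡-mod-sym (seq₂≡seq₁ x)) ∘ p^1∣⇒p∣

lemma2p8 : (p : ℕ) → Prime p → 3 ≤ p →
    (b₁ b₂ b₃ c₁ c₂ c₃ α : ℤ[ p ]) →
    Unit b₁ → Unit b₂ → α ∈pow 1 →
    (α ∈pow 2 ⊎ Unit b₃) →
    ((k : ℤ) → Σ (ℤ[ p ]) (λ x₁ → Σ (ℤ[ p ]) (λ x₂ → Σ (ℤ[ p ]) (λ x₃ →
      (b₁ *ₚ x₁ *ₚ x₁ +ₚ c₁ *ₚ x₁ +ₚ b₂ *ₚ x₂ *ₚ x₂ +ₚ c₂ *ₚ x₂
        +ₚ α *ₚ (b₃ *ₚ x₃ *ₚ x₃ +ₚ c₃ *ₚ x₃)) ≡[mod-pow 2 ] k)))) →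
    LegendreIsOne (red (-ₚ (b₁ *ₚ b₂))) p
lemma2p8 p p-prime p≥3 b₁ b₂ b₃ c₁ c₂ c₃ α b₁-unit b₂-unit α∈pℤₚ α∈p²ℤₚ⊎b₃-unit f-onto =
  p∤-b₁b₂ ,
  map₂ ∣-difference (decidable-stable (square-mod? {{prime⇒nonZero p-prime}} _) ¬¬square)
  where
  [_]₂ : ℤ[ p ] → ℤ
  [ x ]₂ = seq x 2
  p∤-b₁b₂ : ¬ + p ∣ - (red b₁ * red b₂)
  p∤-b₁b₂ = prime-∤-* p-prime (b₁-unit ∘ p∣⇒p^1∣) (b₂-unit ∘ p∣⇒p^1∣)
          ∘ subst (+ p ∣_) (neg-involutive _) ∘ ∣m⇒∣-m
  onto : ∀ k → Σ ℤ λ X₁ → Σ ℤ λ X₂ → Σ ℤ λ X₃ →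
    quadratic [ b₁ ]₂ [ c₁ ]₂ X₁ + quadratic [ b₂ ]₂ [ c₂ ]₂ X₂
      + [ α ]₂ * quadratic [ b₃ ]₂ [ c₃ ]₂ X₃ ≡ k [mod + p * + p ]
  onto k =
    let x₁ , x₂ , x₃ , f≡k = f-onto k
    in [ x₁ ]₂ , [ x₂ ]₂ , [ x₃ ]₂ ,
       ≡-mod (subst (λ z → + p * + p ∣ z + [ α ]₂ * quadratic [ b₃ ]₂ [ c₃ ]₂ [ x₃ ]₂ - k)
                    (+-assoc (quadratic [ b₁ ]₂ [ c₁ ]₂ [ x₁ ]₂)
                             ([ b₂ ]₂ * [ x₂ ]₂ * [ x₂ ]₂) ([ c₂ ]₂ * [ x₂ ]₂))
                    (p^2∣⇒p*p∣ {p = p} f≡k))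
  ¬¬square : ¬ ¬ SquareMod (+ p) (- (red b₁ * red b₂))
  ¬¬square nonsquare =
    represents-mod-p²⇒square p-prime p≥3 [ b₁ ]₂ [ c₁ ]₂ [ b₂ ]₂ [ c₂ ]₂ [ α ]₂ [ b₃ ]₂ [ c₃ ]₂
      (unit⇒p∤seq₂ b₁ b₁-unit) (unit⇒p∤seq₂ b₂ b₂-unit) (∈pow1⇒p∣seq₂ α α∈pℤₚ)
      (Sum.map (∈pow2⇒p*p∣seq₂ α) (unit⇒p∤seq₂ b₃) α∈p²ℤₚ⊎b₃-unit) onto
      (nonsquare ∘ SquareMod-resp (≡-mod-neg-cong (≡-mod-*-cong (seq₂≡seq₁ b₁) (seq₂≡seq₁ b₂))))
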